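{- Let $d\geqslant 1$, let $\mathcal{I}$ be a set of integer intervals $[\ell,r]\subseteq[d]$ with $\ell\leqslant r$, and let $\mathcal{G}=\{\mathbf{g}_{\ell,r} : [\ell,r]\in\mathcal{I}\}$, where $\mathbf{g}_{\ell,r}\in\{0,1\}^d$ has $i$-th coordinate $1$ if $i\in[\ell,r]$ and $0$ otherwise. Let $\mathbf{a}\in\mathbb{Z}_+^d$ and $C\in\mathbb{Z}_+\cup\{\infty\}$, and set $a_0:=0$ and $a_{d+1}:=0$. Let $D$ be the network with node set $[d+1]$ and arc multiset consisting of the arcs $(i,i+1)$ and $(i+1,i)$ for $i\in[d]$, each with capacity $C$ and cost $1$, together with one arc $(\ell,r+1)$ for each $[\ell,r]\in\mathcal{I}$, with infinite capacity and cost $0$ (parallel arcs are kept). Give each node $j\in[d+1]$ the demand $a_{j-1}-a_j$ (i.e., in a feasible flow, the inflow minus the outflow at node $j$ equals $a_{j-1}-a_j$). Then the optimal value $\mathrm{OPT}$ of the CVP instance $(\mathcal{G},\mathbf{a},C)$ equals the minimum cost of a feasible flow in $D$ (both being $\infty$ if no feasible solution exists).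
   Context: The Closest Vector Problem (CVP): given binary generators $\mathbf{g}_1,\dots,\mathbf{g}_k\in\{0,1\}^d$, a target $\mathbf{a}\in\mathbb{Z}_+^d$ and $C\in\mathbb{Z}_+\cup\{\infty\}$, among all $\mathbf{b}=\sum_j u_j\mathbf{g}_j$ with $u_j\in\mathbb{Z}_+$ satisfying $\|\mathbf{a}-\mathbf{b}\|_\infty\leqslant C$, minimize $\|\mathbf{a}-\mathbf{b}\|_1$. $\mathrm{OPT}$ denotes this minimum, with $\mathrm{OPT}=\infty$ if no such $\mathbf{b}$ exists. $[k]=\{1,\dots,k\}$ and $[\ell,r]=\{\ell,\dots,r\}$. -}

module Defs where

open import Data.Nat using (ℕ; zero; suc; _+_; _*_; _≤_; _<_; _≤?_; _<?_; _≟_; ∣_-_∣)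
open import Data.Integer as ℤ using (ℤ; +_)
open import Data.Fin using (Fin; toℕ; fromℕ<)
open import Relation.Binary.PropositionalEquality using (_≡_)
open import Data.List using (List; []; _∷_; _++_; length; lookup; map; concatMap; upTo)
open import Data.Maybe using (Maybe; just; nothing)
open import Data.Product using (_×_; _,_; ∃; Σ)
open import Data.Unit using (⊤)
open import Relation.Nullary using (¬_; yes; no)
open import Relation.Nullary.Decidable using (⌊_⌋)
open import Data.Bool using (if_then_else_; _∧_)

∑ : (m : ℕ) → (Fin m → ℕ) → ℕ
∑ zero    f = 0
∑ (suc m) f = f Fin.zero + ∑ m (λ k → f (Fin.suc k))

-- Extended values: C ∈ ℤ₊ ∪ {∞}; `nothing` stands for ∞.
ℕ∞ : Set
ℕ∞ = Maybe ℕ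

_≤∞_ : ℕ → ℕ∞ → Set
x ≤∞ just c  = x ≤ c
x ≤∞ nothing = ⊤

IsMin : (ℕ → Set) → ℕ → Set
IsMin P v = P v × (∀ w → P w → v ≤ w)

-- Closest Vector Problem with interval generators.
-- Coordinates i ∈ [d] are represented by i : Fin d, standing for toℕ i + 1.
-- An interval [ℓ,r] is a pair (ℓ , r) of naturals.

Interval : Set
Interval = ℕ × ℕ

ValidInterval : ℕ → Interval → Set
ValidInterval d (ℓ , r) = (1 ≤ ℓ) × (ℓ ≤ r) × (r ≤ d)

gen : Interval → ℕ → ℕ
gen (ℓ , r) i = if ⌊ ℓ ≤? i ⌋ ∧ ⌊ i ≤? r ⌋ then 1 else 0

combo : (d : ℕ) (I : List Interval) → (Fin (length I) → ℕ) → Fin d → ℕ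
combo d I u i = ∑ (length I) (λ j → u j * gen (lookup I j) (suc (toℕ i)))

CVPFeasible : (d : ℕ) (I : List Interval) (a : Fin d → ℕ) (C : ℕ∞) →
              (Fin (length I) → ℕ) → Set
CVPFeasible d I a C u = ∀ i → ∣ a i - combo d I u i ∣ ≤∞ C

CVPCost : (d : ℕ) (I : List Interval) (a : Fin d → ℕ) → (Fin (length I) → ℕ) → ℕ
CVPCost d I a u = ∑ d (λ i → ∣ a i - combo d I u i ∣)

CVPAchieves : (d : ℕ) (I : List Interval) (a : Fin d → ℕ) (C : ℕ∞) → ℕ → Set
CVPAchieves d I a C v =
  ∃ λ (u : Fin (length I) → ℕ) → CVPFeasible d I a C u × CVPCost d I a u ≡ v

CVPFeasibleExists : (d : ℕ) (I : List Interval) (a : Fin d → ℕ) (C : ℕ∞) → Set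
CVPFeasibleExists d I a C = ∃ λ (u : Fin (length I) → ℕ) → CVPFeasible d I a C u

-- Networks: a multiset of arcs given as a list (parallel arcs allowed).
-- Nodes are natural numbers; the node set is [n] = {1,…,n}.

record Arc : Set where
  constructor arc
  field
    tail : ℕ
    head : ℕ
    cap  : ℕ∞
    cost : ℕ
open Arc public

Network : Set
Network = List Arc

Flow : Network → Set
Flow N = Fin (length N) → ℕ

inflow : (N : Network) → Flow N → ℕ → ℕ
inflow N f j = ∑ (length N) (λ k → if ⌊ head (lookup N k) ≟ j ⌋ then f k else 0)

outflow : (N : Network) → Flow N → ℕ → ℕ
outflow N f j = ∑ (length N) (λ k → if ⌊ tail (lookup N k) ≟ j ⌋ then f k else 0)

FlowFeasible : (N : Network) (n : ℕ) (dem : ℕ → ℤ) → Flow N → Set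
FlowFeasible N n dem f =
  (∀ k → f k ≤∞ cap (lookup N k)) ×
  (∀ j → 1 ≤ j → j ≤ n → (+ inflow N f j) ℤ.- (+ outflow N f j) ≡ dem j)

flowCost : (N : Network) → Flow N → ℕ
flowCost N f = ∑ (length N) (λ k → cost (lookup N k) * f k)

FlowAchieves : (N : Network) (n : ℕ) (dem : ℕ → ℤ) → ℕ → Set
FlowAchieves N n dem v = ∃ λ (f : Flow N) → FlowFeasible N n dem f × flowCost N f ≡ v

FlowFeasibleExists : (N : Network) (n : ℕ) (dem : ℕ → ℤ) → Set
FlowFeasibleExists N n dem = ∃ λ (f : Flow N) → FlowFeasible N n dem f

aExt : (d : ℕ) → (Fin d → ℕ) → ℕ → ℕ
aExt d a zero = 0
aExt d a (suc k) with k <? d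
... | yes p = a (fromℕ< p)
... | no  _ = 0

-- demand of node j: a_{j-1} − a_j   (only used for j ∈ [d+1])
demand : (d : ℕ) → (Fin d → ℕ) → ℕ → ℤ
demand d a zero    = + 0
demand d a (suc k) = (+ aExt d a k) ℤ.- (+ aExt d a (suc k))

D : (d : ℕ) → List Interval → ℕ∞ → Network
D d I C =
  concatMap (λ k → arc (suc k) (suc (suc k)) C 1 ∷ arc (suc (suc k)) (suc k) C 1 ∷ []) (upTo d)
  ++ map (λ { (ℓ , r) → arc ℓ (suc r) nothing 0 }) I

-- A flow on D is given by its flows p on the arcs (i, i+1), q on the arcs (i+1, i)
-- and u on the interval arcs.  Put b = Σ u_k g_k.  The interval arcs entering and
-- leaving node j+1 account exactly for b_{j+1} − b_j, so conservation at node j+1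
-- says that the excess (p_j + b_j) − (q_j + a_j) at coordinate j equals the one at
-- coordinate j+1.  As the excess vanishes at coordinate 0, conservation on [d+1] is
-- equivalent to p_i − q_i = a_i − b_i for all i ∈ [d].  Such (p, q) exist within
-- capacity C iff ‖a − b‖∞ ≤ C, and the cheapest choice (a_i − b_i)⁺, (b_i − a_i)⁺
-- costs exactly ‖a − b‖₁.
module Submission where

open import Defs
open import Data.Bool using (Bool; true; false; if_then_else_; _∧_)
open import Data.Bool.Properties using (∧-zeroʳ)
open import Data.Empty using (⊥-elim)
open import Data.Fin using (Fin; zero; suc; toℕ; fromℕ<)
open import Data.Fin.Properties using (toℕ<n; fromℕ<-toℕ; toℕ-fromℕ<)
open import Data.Integer as ℤ using (ℤ)
import Data.Integer.Properties as ℤP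
import Data.Integer.Tactic.RingSolver as ℤ-Solver
open import Data.List using (List; []; _∷_; _++_; length; lookup; map; concatMap; applyUpTo)
open import Data.List.Membership.Propositional.Properties using (∈-lookup)
open import Data.List.Relation.Unary.All as All using (All)
open import Data.List.Relation.Unary.Unique.Propositional using (Unique)
open import Data.Maybe using (just; nothing)
open import Data.Nat using (ℕ; zero; suc; _+_; _*_; _∸_; _≤_; _<_; _≤?_; _<?_; _≟_; ∣_-_∣; z≤n; s≤s)
open import Data.Nat.Properties
open import Data.Nat.Tactic.RingSolver using (solve-∀)
open import Data.Product using (_×_; _,_; proj₁; proj₂; ∃)
open import Data.Sum using (inj₁; inj₂)
open import Data.Unit using (tt)
open import Function using (_∘_; _⇔_; mk⇔; Equivalence)
open import Function.Construct.Composition using (_⇔-∘_)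
open import Function.Construct.Identity using (⇔-id)
open import Relation.Binary.PropositionalEquality
open import Relation.Binary using (tri<; tri≈; tri>)
open import Relation.Nullary using (¬_; Dec; yes; no)
open import Relation.Nullary.Decidable using (⌊_⌋; isYes≗does; dec-true; dec-false)

open import Algebra.Properties.CommutativeMonoid.Sum +-0-commutativeMonoid
  using (sum; sum-cong-≗; ∑-distrib-+; sum-replicate-zero)
open Equivalence using (to; from)

⌊⌋-true : ∀ {A : Set} (a? : Dec A) → A → ⌊ a? ⌋ ≡ true
⌊⌋-true a? a = trans (isYes≗does a?) (dec-true a? a)

⌊⌋-false : ∀ {A : Set} (a? : Dec A) → ¬ A → ⌊ a? ⌋ ≡ false
⌊⌋-false a? ¬a = trans (isYes≗does a?) (dec-false a? ¬a)

≟-suc : ∀ m n → ⌊ suc m ≟ suc n ⌋ ≡ ⌊ m ≟ n ⌋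
≟-suc m n = by-cases (m ≟ n)
  where
  by-cases : Dec (m ≡ n) → ⌊ suc m ≟ suc n ⌋ ≡ ⌊ m ≟ n ⌋
  by-cases (yes m≡n) = trans (⌊⌋-true (suc m ≟ suc n) (cong suc m≡n)) (sym (⌊⌋-true (m ≟ n) m≡n))
  by-cases (no  m≢n) = trans (⌊⌋-false (suc m ≟ suc n) (m≢n ∘ suc-injective)) (sym (⌊⌋-false (m ≟ n) m≢n))

*-if : ∀ u b → u * (if b then 1 else 0) ≡ (if b then u else 0)
*-if u true  = *-identityʳ u
*-if u false = *-zeroʳ u

∑≡sum : ∀ m (f : Fin m → ℕ) → ∑ m f ≡ sum f
∑≡sum zero    f = refl
∑≡sum (suc m) f = cong (f zero +_) (∑≡sum m (f ∘ suc))

∑-cong : ∀ m {f g : Fin m → ℕ} → (∀ i → f i ≡ g i) → ∑ m f ≡ ∑ m g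
∑-cong m {f} {g} f≗g rewrite ∑≡sum m f | ∑≡sum m g = sum-cong-≗ f≗g

∑-+ : ∀ m (f g : Fin m → ℕ) → ∑ m (λ i → f i + g i) ≡ ∑ m f + ∑ m g
∑-+ m f g rewrite ∑≡sum m (λ i → f i + g i) | ∑≡sum m f | ∑≡sum m g = ∑-distrib-+ f g

∑-zero : ∀ m → ∑ m (λ _ → 0) ≡ 0
∑-zero m rewrite ∑≡sum m (λ _ → 0) = sum-replicate-zero m

∑-mono-≤ : ∀ m {f g : Fin m → ℕ} → (∀ i → f i ≤ g i) → ∑ m f ≤ ∑ m g
∑-mono-≤ zero    f≤g = z≤n
∑-mono-≤ (suc m) f≤g = +-mono-≤ (f≤g zero) (∑-mono-≤ m (f≤g ∘ suc))

∑-if-false : ∀ m (b : Fin m → Bool) (f : Fin m → ℕ) → (∀ i → b i ≡ false) →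
             ∑ m (λ i → if b i then f i else 0) ≡ 0
∑-if-false m b f off = trans (∑-cong m (λ i → cong (λ c → if c then f i else 0) (off i))) (∑-zero m)

entry : ∀ {n} → (Fin n → ℕ) → ℕ → ℕ
entry {n} p j = ∑ n (λ i → if ⌊ suc (toℕ i) ≟ j ⌋ then p i else 0)

entry-outside : ∀ {n} (p : Fin n → ℕ) j → (∀ i → suc (toℕ i) ≢ j) → entry p j ≡ 0
entry-outside p j outside = ∑-if-false _ _ p (λ i → ⌊⌋-false (suc (toℕ i) ≟ j) (outside i))

entry-at : ∀ {n} (p : Fin n → ℕ) i → entry p (suc (toℕ i)) ≡ p i
entry-at p zero = trans (cong (p zero +_) (∑-if-false _ _ (p ∘ suc) (λ i → ⌊⌋-false (suc (suc (toℕ i)) ≟ 1) λ ())))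
                        (+-identityʳ (p zero))
entry-at {suc n} p (suc i) = begin
  0 + ∑ n (λ k → if ⌊ suc (suc (toℕ k)) ≟ suc (suc (toℕ i)) ⌋ then p (suc k) else 0)
    ≡⟨ ∑-cong n (λ k → cong (λ c → if c then p (suc k) else 0) (≟-suc (suc (toℕ k)) (suc (toℕ i)))) ⟩
  entry (p ∘ suc) (suc (toℕ i))
    ≡⟨ entry-at (p ∘ suc) i ⟩
  p (suc i) ∎
  where open ≡-Reasoning

m∸n+n≡n∸m+m : ∀ m n → (m ∸ n) + n ≡ (n ∸ m) + m
m∸n+n≡n∸m+m m n with ≤-total m n
... | inj₁ m≤n = trans (cong (_+ n) (m≤n⇒m∸n≡0 m≤n)) (sym (m∸n+n≡m m≤n))
... | inj₂ n≤m = trans (m∸n+n≡m n≤m) (cong (_+ m) (sym (m≤n⇒m∸n≡0 n≤m)))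

m∸n+n∸m≡∣m-n∣ : ∀ m n → (m ∸ n) + (n ∸ m) ≡ ∣ m - n ∣
m∸n+n∸m≡∣m-n∣ m n with ≤-total m n
... | inj₁ m≤n = trans (cong (_+ (n ∸ m)) (m≤n⇒m∸n≡0 m≤n)) (sym (m≤n⇒∣m-n∣≡n∸m m≤n))
... | inj₂ n≤m = trans (cong ((m ∸ n) +_) (m≤n⇒m∸n≡0 n≤m))
                       (trans (+-identityʳ _) (sym (m≤n⇒∣n-m∣≡n∸m n≤m)))

m+n≡o+p⇒∣p-n∣≡∣m-o∣ : ∀ m n o p → m + n ≡ o + p → ∣ p - n ∣ ≡ ∣ m - o ∣
m+n≡o+p⇒∣p-n∣≡∣m-o∣ m n o p eq = begin
  ∣ p - n ∣             ≡⟨ ∣m+n-m+o∣≡∣n-o∣ m p n ⟨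
  ∣ m + p - m + n ∣     ≡⟨ cong (λ t → ∣ m + p - t ∣) eq ⟩
  ∣ m + p - o + p ∣     ≡⟨ cong₂ ∣_-_∣ (+-comm m p) (+-comm o p) ⟩
  ∣ p + m - p + o ∣     ≡⟨ ∣m+n-m+o∣≡∣n-o∣ p m o ⟩
  ∣ m - o ∣             ∎
  where open ≡-Reasoning

balance-transfer : ∀ {c c′ x₀ y₀ x₁ y₁} → c + (x₁ + y₀) ≡ c′ + (x₀ + y₁) → x₀ ≡ y₀ →
                   (c ≡ c′ ⇔ x₁ ≡ y₁)
balance-transfer {c} {c′} {x₀} {_} {x₁} {y₁} flux refl = mk⇔ forward backward
  where
  forward : c ≡ c′ → x₁ ≡ y₁
  forward refl = +-cancelʳ-≡ x₀ x₁ y₁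
    (trans (+-cancelˡ-≡ c (x₁ + x₀) (x₀ + y₁) flux) (+-comm x₀ y₁))
  backward : x₁ ≡ y₁ → c ≡ c′
  backward refl = +-cancelʳ-≡ (x₁ + x₀) c c′
    (trans (+-comm c _) (trans (+-comm _ c) (trans flux (cong (c′ +_) (+-comm x₀ x₁)))))

i-j≡k-l⇔i+l≡k+j : ∀ (i j k l : ℤ) → (i ℤ.- j ≡ k ℤ.- l) ⇔ (i ℤ.+ l ≡ k ℤ.+ j)
i-j≡k-l⇔i+l≡k+j i j k l = mk⇔ forward backward
  where
  open ≡-Reasoning
  forward : i ℤ.- j ≡ k ℤ.- l → i ℤ.+ l ≡ k ℤ.+ j
  forward eq = begin
    i ℤ.+ l                    ≡⟨ ℤ-Solver.solve (i ∷ j ∷ l ∷ []) ⟩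
    (i ℤ.- j) ℤ.+ (j ℤ.+ l)    ≡⟨ cong (ℤ._+ (j ℤ.+ l)) eq ⟩
    (k ℤ.- l) ℤ.+ (j ℤ.+ l)    ≡⟨ ℤ-Solver.solve (k ∷ j ∷ l ∷ []) ⟩
    k ℤ.+ j                    ∎
  backward : i ℤ.+ l ≡ k ℤ.+ j → i ℤ.- j ≡ k ℤ.- l
  backward eq = begin
    i ℤ.- j                    ≡⟨ ℤ-Solver.solve (i ∷ j ∷ l ∷ []) ⟩
    (i ℤ.+ l) ℤ.- (j ℤ.+ l)    ≡⟨ cong (ℤ._- (j ℤ.+ l)) eq ⟩
    (k ℤ.+ j) ℤ.- (j ℤ.+ l)    ≡⟨ ℤ-Solver.solve (k ∷ j ∷ l ∷ []) ⟩
    k ℤ.- l                    ∎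

+m++n≡+o++p⇔m+n≡o+p : ∀ m n o p → (ℤ.+ m ℤ.+ ℤ.+ n ≡ ℤ.+ o ℤ.+ ℤ.+ p) ⇔ (m + n ≡ o + p)
+m++n≡+o++p⇔m+n≡o+p m n o p = mk⇔
  (λ eq → ℤP.+-injective (trans (ℤP.pos-+ m n) (trans eq (sym (ℤP.pos-+ o p)))))
  (λ eq → trans (sym (ℤP.pos-+ m n)) (trans (cong ℤ.+_ eq) (ℤP.pos-+ o p)))

≤∞-trans : ∀ {m n} C → m ≤ n → n ≤∞ C → m ≤∞ C
≤∞-trans (just c) m≤n n≤c = ≤-trans m≤n n≤c
≤∞-trans nothing  _   _   = tt

∣-∣-≤∞ : ∀ {m n} C → m ≤∞ C → n ≤∞ C → ∣ m - n ∣ ≤∞ C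
∣-∣-≤∞ {m} {n} (just c) m≤c n≤c = ≤-trans (∣m-n∣≤m⊔n m n) (⊔-lub m≤c n≤c)
∣-∣-≤∞         nothing  _   _   = tt

gen-inside : ∀ {ℓ r j} → ℓ ≤ j → j ≤ r → gen (ℓ , r) j ≡ 1
gen-inside {ℓ} {r} {j} ℓ≤j j≤r =
  cong₂ (λ b c → if b ∧ c then 1 else 0) (⌊⌋-true (ℓ ≤? j) ℓ≤j) (⌊⌋-true (j ≤? r) j≤r)

gen-below : ∀ {ℓ r j} → j < ℓ → gen (ℓ , r) j ≡ 0
gen-below {ℓ} {r} {j} j<ℓ =
  cong (λ b → if b ∧ ⌊ j ≤? r ⌋ then 1 else 0) (⌊⌋-false (ℓ ≤? j) (<⇒≱ j<ℓ))

gen-above : ∀ {ℓ r j} → r < j → gen (ℓ , r) j ≡ 0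
gen-above {ℓ} {r} {j} r<j = cong (λ b → if b then 1 else 0)
  (trans (cong (⌊ ℓ ≤? j ⌋ ∧_) (⌊⌋-false (j ≤? r) (<⇒≱ r<j))) (∧-zeroʳ ⌊ ℓ ≤? j ⌋))

-- g(j+1) − g(j) = [ℓ = j+1] − [r+1 = j+1], moved so that no subtraction occurs.
gen-step : ∀ {ℓ r} → ℓ ≤ r → ∀ j →
           gen (ℓ , r) j + (if ⌊ ℓ ≟ suc j ⌋ then 1 else 0) ≡
           gen (ℓ , r) (suc j) + (if ⌊ suc r ≟ suc j ⌋ then 1 else 0)
gen-step {ℓ} {r} ℓ≤r j with <-cmp (suc j) ℓ
... | tri< j+1<ℓ _ _
  rewrite gen-below {ℓ} {r} (<-trans (n<1+n j) j+1<ℓ) | gen-below {ℓ} {r} j+1<ℓ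
        | ⌊⌋-false (ℓ ≟ suc j) (>⇒≢ j+1<ℓ)
        | ⌊⌋-false (suc r ≟ suc j) (>⇒≢ (s≤s (≤-trans (<⇒≤ j+1<ℓ) ℓ≤r))) = refl
... | tri≈ _ refl _
  rewrite gen-below {suc j} {r} (n<1+n j) | gen-inside {suc j} {r} ≤-refl ℓ≤r
        | ⌊⌋-true (suc j ≟ suc j) refl | ⌊⌋-false (suc r ≟ suc j) (>⇒≢ (s≤s ℓ≤r)) = refl
... | tri> _ _ ℓ<j+1 with <-cmp j r
...   | tri< j<r _ _
  rewrite gen-inside {ℓ} {r} (≤-pred ℓ<j+1) (<⇒≤ j<r)
        | gen-inside {ℓ} {r} (<⇒≤ ℓ<j+1) j<r
        | ⌊⌋-false (ℓ ≟ suc j) (<⇒≢ ℓ<j+1) | ⌊⌋-false (suc r ≟ suc j) (>⇒≢ (s≤s j<r)) = refl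
...   | tri≈ _ refl _
  rewrite gen-inside {ℓ} {j} (≤-pred ℓ<j+1) ≤-refl | gen-above {ℓ} {j} (n<1+n j)
        | ⌊⌋-false (ℓ ≟ suc j) (<⇒≢ ℓ<j+1) | ⌊⌋-true (suc j ≟ suc j) refl = refl
...   | tri> _ _ r<j
  rewrite gen-above {ℓ} {r} r<j | gen-above {ℓ} {r} (<-trans r<j (n<1+n j))
        | ⌊⌋-false (ℓ ≟ suc j) (<⇒≢ ℓ<j+1) | ⌊⌋-false (suc r ≟ suc j) (<⇒≢ (s≤s r<j)) = refl

*-gen-step : ∀ w {ℓ r} → ℓ ≤ r → ∀ j →
             w * gen (ℓ , r) j + (if ⌊ ℓ ≟ suc j ⌋ then w else 0) ≡
             w * gen (ℓ , r) (suc j) + (if ⌊ suc r ≟ suc j ⌋ then w else 0)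
*-gen-step w {ℓ} {r} ℓ≤r j = begin
  w * gen (ℓ , r) j + (if ⌊ ℓ ≟ suc j ⌋ then w else 0)
    ≡⟨ cong (w * gen (ℓ , r) j +_) (*-if w _) ⟨
  w * gen (ℓ , r) j + w * (if ⌊ ℓ ≟ suc j ⌋ then 1 else 0)
    ≡⟨ *-distribˡ-+ w _ _ ⟨
  w * (gen (ℓ , r) j + (if ⌊ ℓ ≟ suc j ⌋ then 1 else 0))
    ≡⟨ cong (w *_) (gen-step ℓ≤r j) ⟩
  w * (gen (ℓ , r) (suc j) + (if ⌊ suc r ≟ suc j ⌋ then 1 else 0))
    ≡⟨ *-distribˡ-+ w _ _ ⟩
  w * gen (ℓ , r) (suc j) + w * (if ⌊ suc r ≟ suc j ⌋ then 1 else 0)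
    ≡⟨ cong (w * gen (ℓ , r) (suc j) +_) (*-if w _) ⟩
  w * gen (ℓ , r) (suc j) + (if ⌊ suc r ≟ suc j ⌋ then w else 0) ∎
  where open ≡-Reasoning

arcSum : (N : Network) → (Arc → ℕ → ℕ) → Flow N → ℕ
arcSum N G f = ∑ (length N) (λ k → G (lookup N k) (f k))

inject-++ˡ : ∀ (A B : Network) → Fin (length A) → Fin (length (A ++ B))
inject-++ˡ (_ ∷ A) B zero    = zero
inject-++ˡ (_ ∷ A) B (suc k) = suc (inject-++ˡ A B k)

inject-++ʳ : ∀ (A B : Network) → Fin (length B) → Fin (length (A ++ B))
inject-++ʳ []      B k = k
inject-++ʳ (_ ∷ A) B k = suc (inject-++ʳ A B k)

flow-++ : ∀ (A B : Network) → Flow A → Flow B → Flow (A ++ B)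
flow-++ []      B g h k       = h k
flow-++ (_ ∷ A) B g h zero    = g zero
flow-++ (_ ∷ A) B g h (suc k) = flow-++ A B (g ∘ suc) h k

arcSum-++ : ∀ A B G (f : Flow (A ++ B)) →
            arcSum (A ++ B) G f ≡ arcSum A G (f ∘ inject-++ˡ A B) + arcSum B G (f ∘ inject-++ʳ A B)
arcSum-++ []      B G f = refl
arcSum-++ (e ∷ A) B G f =
  trans (cong (G e (f zero) +_) (arcSum-++ A B G (f ∘ suc))) (sym (+-assoc (G e (f zero)) _ _))

arcSum-flow-++ : ∀ A B G (g : Flow A) (h : Flow B) →
                 arcSum (A ++ B) G (flow-++ A B g h) ≡ arcSum A G g + arcSum B G h
arcSum-flow-++ []      B G g h = refl
arcSum-flow-++ (e ∷ A) B G g h =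
  trans (cong (G e (g zero) +_) (arcSum-flow-++ A B G (g ∘ suc) h)) (sym (+-assoc (G e (g zero)) _ _))

lookup-inject-++ˡ : ∀ A B k → lookup (A ++ B) (inject-++ˡ A B k) ≡ lookup A k
lookup-inject-++ˡ (_ ∷ A) B zero    = refl
lookup-inject-++ˡ (_ ∷ A) B (suc k) = lookup-inject-++ˡ A B k

flow-++-respects : ∀ (R : Arc → ℕ → Set) A B (g : Flow A) (h : Flow B) →
                   (∀ k → R (lookup A k) (g k)) → (∀ k → R (lookup B k) (h k)) →
                   ∀ k → R (lookup (A ++ B) k) (flow-++ A B g h k)
flow-++-respects R []      B g h Rg Rh k       = Rh k
flow-++-respects R (_ ∷ A) B g h Rg Rh zero    = Rg zero
flow-++-respects R (_ ∷ A) B g h Rg Rh (suc k) = flow-++-respects R A B (g ∘ suc) h (Rg ∘ suc) Rh k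

forwardArc backwardArc : ℕ∞ → ℕ → Arc
forwardArc  C k = arc (suc k) (suc (suc k)) C 1
backwardArc C k = arc (suc (suc k)) (suc k) C 1

-- D uses g = id (upTo d is applyUpTo id d); a general g is what makes induction on n possible.
pathNetwork : ℕ∞ → (ℕ → ℕ) → ℕ → Network
pathNetwork C g n = concatMap (λ k → forwardArc C k ∷ backwardArc C k ∷ []) (applyUpTo g n)

forwardIndex backwardIndex : ∀ C g n → Fin n → Fin (length (pathNetwork C g n))
forwardIndex  C g (suc n) zero    = zero
forwardIndex  C g (suc n) (suc i) = suc (suc (forwardIndex C (g ∘ suc) n i))
backwardIndex C g (suc n) zero    = suc zero
backwardIndex C g (suc n) (suc i) = suc (suc (backwardIndex C (g ∘ suc) n i))

pathFlow : ∀ C g n → (Fin n → ℕ) → (Fin n → ℕ) → Flow (pathNetwork C g n)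
pathFlow C g (suc n) p q zero          = p zero
pathFlow C g (suc n) p q (suc zero)    = q zero
pathFlow C g (suc n) p q (suc (suc k)) = pathFlow C (g ∘ suc) n (p ∘ suc) (q ∘ suc) k

pathSum : ℕ∞ → (ℕ → ℕ) → ∀ n → (Arc → ℕ → ℕ) → (Fin n → ℕ) → (Fin n → ℕ) → ℕ
pathSum C g n G p q = ∑ n (λ i → G (forwardArc C (g (toℕ i))) (p i) + G (backwardArc C (g (toℕ i))) (q i))

arcSum-pathNetwork : ∀ C g n G (f : Flow (pathNetwork C g n)) →
  arcSum (pathNetwork C g n) G f ≡ pathSum C g n G (f ∘ forwardIndex C g n) (f ∘ backwardIndex C g n)
arcSum-pathNetwork C g zero    G f = refl
arcSum-pathNetwork C g (suc n) G f =
  trans (cong (λ t → G (forwardArc C (g 0)) (f zero) + (G (backwardArc C (g 0)) (f (suc zero)) + t))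
              (arcSum-pathNetwork C (g ∘ suc) n G (λ k → f (suc (suc k)))))
        (sym (+-assoc (G (forwardArc C (g 0)) (f zero)) _ _))

arcSum-pathFlow : ∀ C g n G p q → arcSum (pathNetwork C g n) G (pathFlow C g n p q) ≡ pathSum C g n G p q
arcSum-pathFlow C g zero    G p q = refl
arcSum-pathFlow C g (suc n) G p q =
  trans (cong (λ t → G (forwardArc C (g 0)) (p zero) + (G (backwardArc C (g 0)) (q zero) + t))
              (arcSum-pathFlow C (g ∘ suc) n G (p ∘ suc) (q ∘ suc)))
        (sym (+-assoc (G (forwardArc C (g 0)) (p zero)) _ _))

cap-forwardIndex : ∀ C g n i → cap (lookup (pathNetwork C g n) (forwardIndex C g n i)) ≡ C
cap-forwardIndex C g (suc n) zero    = refl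
cap-forwardIndex C g (suc n) (suc i) = cap-forwardIndex C (g ∘ suc) n i

cap-backwardIndex : ∀ C g n i → cap (lookup (pathNetwork C g n) (backwardIndex C g n i)) ≡ C
cap-backwardIndex C g (suc n) zero    = refl
cap-backwardIndex C g (suc n) (suc i) = cap-backwardIndex C (g ∘ suc) n i

pathFlow-within-cap : ∀ C g n p q → (∀ i → p i ≤∞ C) → (∀ i → q i ≤∞ C) →
                      ∀ k → pathFlow C g n p q k ≤∞ cap (lookup (pathNetwork C g n) k)
pathFlow-within-cap C g (suc n) p q p≤C q≤C zero          = p≤C zero
pathFlow-within-cap C g (suc n) p q p≤C q≤C (suc zero)    = q≤C zero
pathFlow-within-cap C g (suc n) p q p≤C q≤C (suc (suc k)) =
  pathFlow-within-cap C (g ∘ suc) n (p ∘ suc) (q ∘ suc) (p≤C ∘ suc) (q≤C ∘ suc) k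

intervalArc : Interval → Arc
intervalArc x = arc (proj₁ x) (suc (proj₂ x)) nothing 0

intervalNetwork : List Interval → Network
intervalNetwork = map intervalArc

intervalIndex : ∀ I → Fin (length I) → Fin (length (intervalNetwork I))
intervalIndex (_ ∷ I) zero    = zero
intervalIndex (_ ∷ I) (suc k) = suc (intervalIndex I k)

intervalFlow : ∀ I → (Fin (length I) → ℕ) → Flow (intervalNetwork I)
intervalFlow (_ ∷ I) u zero    = u zero
intervalFlow (_ ∷ I) u (suc k) = intervalFlow I (u ∘ suc) k

intervalSum : ∀ I → (Arc → ℕ → ℕ) → (Fin (length I) → ℕ) → ℕ
intervalSum I G u = ∑ (length I) (λ k → G (intervalArc (lookup I k)) (u k))

arcSum-intervalNetwork : ∀ I G (f : Flow (intervalNetwork I)) →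
                         arcSum (intervalNetwork I) G f ≡ intervalSum I G (f ∘ intervalIndex I)
arcSum-intervalNetwork []      G f = refl
arcSum-intervalNetwork (x ∷ I) G f = cong (G (intervalArc x) (f zero) +_) (arcSum-intervalNetwork I G (f ∘ suc))

arcSum-intervalFlow : ∀ I G u → arcSum (intervalNetwork I) G (intervalFlow I u) ≡ intervalSum I G u
arcSum-intervalFlow []      G u = refl
arcSum-intervalFlow (x ∷ I) G u = cong (G (intervalArc x) (u zero) +_) (arcSum-intervalFlow I G (u ∘ suc))

intervalNetwork-uncapacitated : ∀ I (f : Flow (intervalNetwork I)) k → f k ≤∞ cap (lookup (intervalNetwork I) k)
intervalNetwork-uncapacitated (_ ∷ I) f zero    = tt
intervalNetwork-uncapacitated (_ ∷ I) f (suc k) = intervalNetwork-uncapacitated I (f ∘ suc) k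

module OnD (d : ℕ) (I : List Interval) (valid : All (ValidInterval d) I) (a : Fin d → ℕ) (C : ℕ∞) where

  -- D d I C is definitionally Paths ++ Intervals.
  Paths Intervals : Network
  Paths     = pathNetwork C (λ x → x) d
  Intervals = intervalNetwork I

  Decomposes : Flow (D d I C) → (Fin d → ℕ) → (Fin d → ℕ) → (Fin (length I) → ℕ) → Set
  Decomposes f p q u = ∀ G → arcSum (D d I C) G f ≡ pathSum C (λ x → x) d G p q + intervalSum I G u

  forwardFlow backwardFlow : Flow (D d I C) → Fin d → ℕ
  forwardFlow  f i = f (inject-++ˡ Paths Intervals (forwardIndex C (λ x → x) d i))
  backwardFlow f i = f (inject-++ˡ Paths Intervals (backwardIndex C (λ x → x) d i))

  intervalFlows : Flow (D d I C) → Fin (length I) → ℕ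
  intervalFlows f k = f (inject-++ʳ Paths Intervals (intervalIndex I k))

  decomposes-components : ∀ f → Decomposes f (forwardFlow f) (backwardFlow f) (intervalFlows f)
  decomposes-components f G = trans (arcSum-++ Paths Intervals G f)
    (cong₂ _+_ (arcSum-pathNetwork C (λ x → x) d G _) (arcSum-intervalNetwork I G _))

  assemble : (Fin d → ℕ) → (Fin d → ℕ) → (Fin (length I) → ℕ) → Flow (D d I C)
  assemble p q u = flow-++ Paths Intervals (pathFlow C (λ x → x) d p q) (intervalFlow I u)

  decomposes-assemble : ∀ p q u → Decomposes (assemble p q u) p q u
  decomposes-assemble p q u G = trans (arcSum-flow-++ Paths Intervals G _ _)
    (cong₂ _+_ (arcSum-pathFlow C (λ x → x) d G p q) (arcSum-intervalFlow I G u))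

  load : (Fin (length I) → ℕ) → ℕ → ℕ
  load u j = ∑ (length I) (λ k → u k * gen (lookup I k) j)

  startingAt endingAt : (Fin (length I) → ℕ) → ℕ → ℕ
  startingAt u m = ∑ (length I) (λ k → if ⌊ proj₁ (lookup I k) ≟ m ⌋ then u k else 0)
  endingAt   u m = ∑ (length I) (λ k → if ⌊ suc (proj₂ (lookup I k)) ≟ m ⌋ then u k else 0)

  module _ {f p q u} (dec : Decomposes f p q u) where

    inflow-decomposed : ∀ j → inflow (D d I C) f (suc j) ≡ (entry p j + entry q (suc j)) + endingAt u (suc j)
    inflow-decomposed j = trans (dec (λ e x → if ⌊ head e ≟ suc j ⌋ then x else 0))
      (cong (_+ endingAt u (suc j)) (trans (∑-+ d _ _) (cong (_+ entry q (suc j))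
        (∑-cong d (λ i → cong (λ b → if b then p i else 0) (≟-suc (suc (toℕ i)) j))))))

    outflow-decomposed : ∀ j → outflow (D d I C) f (suc j) ≡ (entry p (suc j) + entry q j) + startingAt u (suc j)
    outflow-decomposed j = trans (dec (λ e x → if ⌊ tail e ≟ suc j ⌋ then x else 0))
      (cong (_+ startingAt u (suc j)) (trans (∑-+ d _ _) (cong (entry p (suc j) +_)
        (∑-cong d (λ i → cong (λ b → if b then q i else 0) (≟-suc (suc (toℕ i)) j))))))

    cost-decomposed : flowCost (D d I C) f ≡ ∑ d (λ i → p i + q i)
    cost-decomposed = trans (dec (λ e x → cost e * x)) (trans
      (cong₂ _+_ (∑-cong d (λ i → cong₂ _+_ (*-identityˡ (p i)) (*-identityˡ (q i)))) (∑-zero (length I)))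
      (+-identityʳ _))

  valid-at : ∀ k → ValidInterval d (lookup I k)
  valid-at k = All.lookup valid (∈-lookup k)

  load-step : ∀ u j → load u j + startingAt u (suc j) ≡ load u (suc j) + endingAt u (suc j)
  load-step u j = begin
    load u j + startingAt u (suc j)
      ≡⟨ ∑-+ (length I) _ _ ⟨
    ∑ (length I) (λ k → u k * gen (lookup I k) j + (if ⌊ proj₁ (lookup I k) ≟ suc j ⌋ then u k else 0))
      ≡⟨ ∑-cong (length I) (λ k → *-gen-step (u k) (proj₁ (proj₂ (valid-at k))) j) ⟩
    ∑ (length I) (λ k → u k * gen (lookup I k) (suc j) + (if ⌊ suc (proj₂ (lookup I k)) ≟ suc j ⌋ then u k else 0))
      ≡⟨ ∑-+ (length I) _ _ ⟩
    load u (suc j) + endingAt u (suc j) ∎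
    where open ≡-Reasoning

  load-vanishes : ∀ u j → (∀ k → gen (lookup I k) j ≡ 0) → load u j ≡ 0
  load-vanishes u j gen≡0 =
    trans (∑-cong (length I) (λ k → trans (cong (u k *_) (gen≡0 k)) (*-zeroʳ (u k)))) (∑-zero (length I))

  aExt-at : ∀ i → aExt d a (suc (toℕ i)) ≡ a i
  aExt-at i with toℕ i <? d
  ... | yes i<d = cong a (fromℕ<-toℕ i i<d)
  ... | no  i≮d = ⊥-elim (i≮d (toℕ<n i))

  aExt-beyond : ∀ k → d ≤ k → aExt d a (suc k) ≡ 0
  aExt-beyond k d≤k with k <? d
  ... | yes k<d = ⊥-elim (<⇒≱ k<d d≤k)
  ... | no  _   = refl

  Balanced : (Fin d → ℕ) → (Fin d → ℕ) → (Fin (length I) → ℕ) → ℕ → Set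
  Balanced p q u j = entry p j + load u j ≡ entry q j + aExt d a j

  Conserved : Flow (D d I C) → ℕ → Set
  Conserved f j = ℤ.+ inflow (D d I C) f j ℤ.- ℤ.+ outflow (D d I C) f j ≡ demand d a j

  balanced-zero : ∀ p q u → Balanced p q u 0
  balanced-zero p q u = begin
    entry p 0 + load u 0  ≡⟨ cong₂ _+_ (entry-outside p 0 (λ _ ())) (load-vanishes u 0 below) ⟩
    0                     ≡⟨ cong (_+ 0) (entry-outside q 0 (λ _ ())) ⟨
    entry q 0 + 0         ∎
    where
    open ≡-Reasoning
    below : ∀ k → gen (lookup I k) 0 ≡ 0
    below k = gen-below {proj₁ (lookup I k)} {proj₂ (lookup I k)} (proj₁ (valid-at k))

  balanced-beyond : ∀ p q u k → d ≤ k → Balanced p q u (suc k)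
  balanced-beyond p q u k d≤k = begin
    entry p (suc k) + load u (suc k)  ≡⟨ cong₂ _+_ (entry-outside p (suc k) outside) (load-vanishes u (suc k) above) ⟩
    0                                 ≡⟨ cong₂ _+_ (entry-outside q (suc k) outside) (aExt-beyond k d≤k) ⟨
    entry q (suc k) + aExt d a (suc k) ∎
    where
    open ≡-Reasoning
    outside : ∀ i → suc (toℕ i) ≢ suc k
    outside i eq = <⇒≱ (toℕ<n i) (≤-trans d≤k (≤-reflexive (sym (suc-injective eq))))
    above : ∀ k′ → gen (lookup I k′) (suc k) ≡ 0
    above k′ = gen-above {proj₁ (lookup I k′)} {proj₂ (lookup I k′)}
                 (s≤s (≤-trans (proj₂ (proj₂ (valid-at k′))) d≤k))

  balanced-at : ∀ p q u i → Balanced p q u (suc (toℕ i)) ⇔ (p i + combo d I u i ≡ q i + a i)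
  balanced-at p q u i rewrite entry-at p i | entry-at q i | aExt-at i = ⇔-id _

  -- In ℤ: (in − out) − (a_j − a_{j+1}) = (x_j − y_j) − (x_{j+1} − y_{j+1}), where x = p + b and y = q + a.
  flux : ∀ {f p q u} → Decomposes f p q u → ∀ j →
         (inflow (D d I C) f (suc j) + aExt d a (suc j)) + ((entry p (suc j) + load u (suc j)) + (entry q j + aExt d a j))
         ≡ (aExt d a j + outflow (D d I C) f (suc j)) + ((entry p j + load u j) + (entry q (suc j) + aExt d a (suc j)))
  flux {f} {p} {q} {u} dec j = +-cancelʳ-≡ (b₀ + out₁) _ _ (begin
    (inflow (D d I C) f (suc j) + a₁) + ((p₁ + b₁) + (q₀ + a₀)) + (b₀ + out₁)
      ≡⟨ cong (λ t → (t + a₁) + ((p₁ + b₁) + (q₀ + a₀)) + (b₀ + out₁)) (inflow-decomposed dec j) ⟩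
    (((p₀ + q₁) + in₁) + a₁) + ((p₁ + b₁) + (q₀ + a₀)) + (b₀ + out₁)
      ≡⟨ rearrange p₀ q₀ p₁ q₁ b₀ b₁ a₀ a₁ in₁ out₁ ⟩
    (a₀ + ((p₁ + q₀) + out₁)) + ((p₀ + b₀) + (q₁ + a₁)) + (b₁ + in₁)
      ≡⟨ cong₂ (λ t s → (a₀ + t) + ((p₀ + b₀) + (q₁ + a₁)) + s) (outflow-decomposed dec j) (load-step u j) ⟨
    (a₀ + outflow (D d I C) f (suc j)) + ((p₀ + b₀) + (q₁ + a₁)) + (b₀ + out₁) ∎)
    where
    open ≡-Reasoning
    p₀ q₀ p₁ q₁ b₀ b₁ a₀ a₁ in₁ out₁ : ℕ
    p₀ = entry p j
    q₀ = entry q j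
    p₁ = entry p (suc j)
    q₁ = entry q (suc j)
    b₀ = load u j
    b₁ = load u (suc j)
    a₀ = aExt d a j
    a₁ = aExt d a (suc j)
    in₁ = endingAt u (suc j)
    out₁ = startingAt u (suc j)
    rearrange : ∀ p₀ q₀ p₁ q₁ b₀ b₁ a₀ a₁ in₁ out₁ →
      (((p₀ + q₁) + in₁) + a₁) + ((p₁ + b₁) + (q₀ + a₀)) + (b₀ + out₁)
      ≡ (a₀ + ((p₁ + q₀) + out₁)) + ((p₀ + b₀) + (q₁ + a₁)) + (b₁ + in₁)
    rearrange = solve-∀

  conserved⇔balanced : ∀ {f p q u} → Decomposes f p q u → ∀ j → Balanced p q u j →
                       Conserved f (suc j) ⇔ Balanced p q u (suc j)
  conserved⇔balanced {f} dec j bal =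
    balance-transfer (flux dec j) bal
      ⇔-∘ (+m++n≡+o++p⇔m+n≡o+p inflow₁ (aExt d a (suc j)) (aExt d a j) outflow₁
      ⇔-∘ i-j≡k-l⇔i+l≡k+j (ℤ.+ inflow₁) (ℤ.+ outflow₁) (ℤ.+ aExt d a j) (ℤ.+ aExt d a (suc j)))
    where
    inflow₁ outflow₁ : ℕ
    inflow₁  = inflow (D d I C) f (suc j)
    outflow₁ = outflow (D d I C) f (suc j)

  flow⇒cvp : ∀ f → FlowFeasible (D d I C) (d + 1) (demand d a) f →
             ∃ λ u → CVPFeasible d I a C u × CVPCost d I a u ≤ flowCost (D d I C) f
  flow⇒cvp f (within-cap , conserved) = u , feasible , cheaper
    where
    p q : Fin d → ℕ
    p = forwardFlow f
    q = backwardFlow f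
    u : Fin (length I) → ℕ
    u = intervalFlows f
    dec : Decomposes f p q u
    dec = decomposes-components f

    balanced : ∀ j → j ≤ d → Balanced p q u j
    balanced zero    _   = balanced-zero p q u
    balanced (suc j) j<d = to (conserved⇔balanced dec j (balanced j (<⇒≤ j<d)))
                              (conserved (suc j) (s≤s z≤n) (≤-trans j<d (m≤m+n d 1)))

    distance : ∀ i → ∣ a i - combo d I u i ∣ ≡ ∣ p i - q i ∣
    distance i = m+n≡o+p⇒∣p-n∣≡∣m-o∣ (p i) (combo d I u i) (q i) (a i)
                   (to (balanced-at p q u i) (balanced (suc (toℕ i)) (toℕ<n i)))

    capacity : ∀ k → cap (lookup Paths k) ≡ C → f (inject-++ˡ Paths Intervals k) ≤∞ C
    capacity k cap≡C = subst (f (inject-++ˡ Paths Intervals k) ≤∞_)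
      (trans (cong cap (lookup-inject-++ˡ Paths Intervals k)) cap≡C) (within-cap _)

    feasible : CVPFeasible d I a C u
    feasible i = subst (_≤∞ C) (sym (distance i))
      (∣-∣-≤∞ C (capacity _ (cap-forwardIndex C (λ x → x) d i))
                (capacity _ (cap-backwardIndex C (λ x → x) d i)))

    cheaper : CVPCost d I a u ≤ flowCost (D d I C) f
    cheaper = ≤-trans
      (∑-mono-≤ d (λ i → ≤-trans (≤-reflexive (distance i))
                                 (≤-trans (∣m-n∣≤m⊔n (p i) (q i)) (m⊔n≤m+n (p i) (q i)))))
      (≤-reflexive (sym (cost-decomposed dec)))

  cvp⇒flow : ∀ u → CVPFeasible d I a C u →
             ∃ λ f → FlowFeasible (D d I C) (d + 1) (demand d a) f × flowCost (D d I C) f ≡ CVPCost d I a u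
  cvp⇒flow u feasible = f , (within-cap , conserved) , cost-equal
    where
    p q : Fin d → ℕ
    p i = a i ∸ combo d I u i
    q i = combo d I u i ∸ a i
    f : Flow (D d I C)
    f = assemble p q u
    dec : Decomposes f p q u
    dec = decomposes-assemble p q u

    balanced : ∀ j → Balanced p q u j
    balanced zero = balanced-zero p q u
    balanced (suc k) with <-≤-connex k d
    ... | inj₁ k<d = subst (Balanced p q u ∘ suc) (toℕ-fromℕ< k<d)
                      (from (balanced-at p q u (fromℕ< k<d)) (m∸n+n≡n∸m+m (a _) (combo d I u _)))
    ... | inj₂ d≤k = balanced-beyond p q u k d≤k

    conserved : ∀ j → 1 ≤ j → j ≤ d + 1 → Conserved f j
    conserved (suc j) _ _ = from (conserved⇔balanced dec j (balanced j)) (balanced (suc j))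

    within-cap : ∀ k → f k ≤∞ cap (lookup (D d I C) k)
    within-cap = flow-++-respects (λ e x → x ≤∞ cap e) Paths Intervals _ _
      (pathFlow-within-cap C (λ x → x) d p q
        (λ i → ≤∞-trans C (m∸n≤∣m-n∣ (a i) (combo d I u i)) (feasible i))
        (λ i → ≤∞-trans C (subst (q i ≤_) (∣-∣-comm (combo d I u i) (a i)) (m∸n≤∣m-n∣ (combo d I u i) (a i))) (feasible i)))
      (intervalNetwork-uncapacitated I _)

    cost-equal : flowCost (D d I C) f ≡ CVPCost d I a u
    cost-equal = trans (cost-decomposed dec) (∑-cong d (λ i → m∸n+n∸m≡∣m-n∣ (a i) (combo d I u i)))

IsMin-transfer : ∀ {P Q : ℕ → Set} → (∀ {v} → P v → Q v) → (∀ {w} → Q w → ∃ λ v → P v × v ≤ w) →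
                 ∀ v → IsMin P v ⇔ IsMin Q v
IsMin-transfer {P} {Q} P⇒Q Q⇒P v = mk⇔
  (λ (Pv , v≤P) → P⇒Q Pv , λ w Qw → let (v′ , Pv′ , v′≤w) = Q⇒P Qw in ≤-trans (v≤P v′ Pv′) v′≤w)
  (λ (Qv , v≤Q) → let (v′ , Pv′ , v′≤v) = Q⇒P Qv in
     subst P (≤-antisym v′≤v (v≤Q v′ (P⇒Q Pv′))) Pv′ , λ w Pw → v≤Q w (P⇒Q Pw))

proposition2 : (d : ℕ) → 1 ≤ d →
    (I : List Interval) → All (ValidInterval d) I → Unique I →
    (a : Fin d → ℕ) → (C : ℕ∞) →
    ((v : ℕ) → IsMin (CVPAchieves d I a C) v ⇔ IsMin (FlowAchieves (D d I C) (d + 1) (demand d a)) v)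
    × ((¬ CVPFeasibleExists d I a C) ⇔ (¬ FlowFeasibleExists (D d I C) (d + 1) (demand d a)))
proposition2 d _ I valid _ a C =
  IsMin-transfer cvp-value⇒flow-value flow-value⇒cvp-value ,
  mk⇔ (λ ¬cvp (f , feasible) → let (u , feasibleᶜ , _) = flow⇒cvp f feasible in ¬cvp (u , feasibleᶜ))
      (λ ¬flow (u , feasible) → let (f , feasibleᶠ , _) = cvp⇒flow u feasible in ¬flow (f , feasibleᶠ))
  where
  open OnD d I valid a C

  cvp-value⇒flow-value : ∀ {v} → CVPAchieves d I a C v → FlowAchieves (D d I C) (d + 1) (demand d a) v
  cvp-value⇒flow-value (u , feasible , refl) = let (f , feasibleᶠ , cost-equal) = cvp⇒flow u feasible in f , feasibleᶠ , cost-equal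

  flow-value⇒cvp-value : ∀ {w} → FlowAchieves (D d I C) (d + 1) (demand d a) w →
                         ∃ λ v → CVPAchieves d I a C v × v ≤ w
  flow-value⇒cvp-value (f , feasible , refl) =
    let (u , feasibleᶜ , cheaper) = flow⇒cvp f feasible in CVPCost d I a u , (u , feasibleᶜ , refl) , cheaper
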